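{- Let $v$ and $s\ge 3$ be integers. If there is a $(3,s,v)$-AONT, then $s\le v+2$ if $v\ge 4$ is even, and $s\le v+1$ if $v\ge 3$ is odd.
   Context: A $(t,s,v)$-all-or-nothing transform (AONT) over an alphabet $X$ with $|X|=v$ (where $1\le t\le s$) is a bijection $\phi: X^s\to X^s$ such that for every $I\subseteq\{1,\dots,s\}$ with $|I|=t$ and every $J\subseteq\{1,\dots,s\}$ with $|J|=t$, for every $\mathbf{a}\in X^{I}$ and every $\mathbf{b}\in X^{\{1,\dots,s\}\setminus J}$ there is exactly one $\mathbf{x}\in X^s$ with $\mathbf{x}|_I=\mathbf{a}$ and $\phi(\mathbf{x})|_{\{1,\dots,s\}\setminus J}=\mathbf{b}$ (i.e., given any $s-t$ outputs, any $t$ inputs are completely undetermined). -}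

module Defs where

open import Data.Nat using (ℕ)
open import Data.Fin using (Fin)
open import Data.Fin.Subset using (Subset; _∈_; _∉_; ∣_∣)
open import Data.Vec using (Vec; lookup)
open import Data.Product using (_×_; ∃!)
open import Function.Definitions using (Bijective)
open import Relation.Binary.PropositionalEquality using (_≡_)

Word : ℕ → ℕ → Set
Word s v = Vec (Fin v) s

-- Partial assignments are represented by full words
-- a, b, of which only the coordinates in I (resp. outside J) matter.
IsAONT : (t s v : ℕ) → (Word s v → Word s v) → Set
IsAONT t s v φ =
  Bijective _≡_ _≡_ φ ×
  (∀ (I J : Subset s) → ∣ I ∣ ≡ t → ∣ J ∣ ≡ t →
     ∀ (a b : Word s v) →
       ∃! _≡_ (λ (x : Word s v) →
         (∀ i → i ∈ I → lookup x i ≡ lookup a i) ×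
         (∀ j → j ∉ J → lookup (φ x) j ≡ lookup b j)))

-- Fixing the outputs of φ outside three positions leaves a set of inputs in which the values at any three
-- coordinates are realised exactly once, i.e. an orthogonal array of strength 3 and index 1.  Fix a codeword
-- a and a coordinate c.  A codeword with the same value at c is determined by its values at two further
-- coordinates, so there are at most v² of them; besides a, they include, for each of the s − 1 coordinates
-- e ≠ c and each of the v − 1 wrong values at some third coordinate, the codeword agreeing with a at c and e.
-- Hence 1 + (s − 1)(v − 1) ≤ v², that is s ≤ v + 2.  When s = v + 2 one more such codeword does not fit, so
-- every codeword sharing a's value at c shares another value with a.  Take, for each coordinate i ≥ 2, the
-- codeword r i with fixed wrong values at coordinates 0 and 1 and a's value at i: it meets a at exactly one
-- further coordinate j ≥ 2 (three agreements would force r i = a), and r i = r j.  So i ↦ j is a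
-- fixed-point-free involution of the s − 2 = v coordinates ≥ 2, and v is even.
module Submission where

open import Defs
open import Data.Nat using (ℕ; _≤_; _+_)
open import Data.Nat.Divisibility using (_∣_)
open import Data.Product using (_×_; ∃)
open import Relation.Nullary using (¬_)

open import Data.Fin using (Fin; zero; suc; punchIn; combine; remQuot; _≟_)
open import Data.Fin.Permutation using (Permutation′; permutation)
open import Data.Fin.Properties
  using (_<?_; <-asym; suc-injective; punchInᵢ≢i; punchIn-injective; combine-injective;
         injective⇒≤; *↔×; any?)
import Data.Fin.Properties as Fin
open import Data.Fin.Subset using (Subset; _∈_; _∉_; ∣_∣; ⁅_⁆; _∪_; inside; outside)
open import Data.Fin.Subset.Properties
  using (∪-identityˡ; x∈p∪q⁺; x∈p∪q⁻; x∈⁅x⁆; x∈⁅y⁆⇒x≡y; ∣⁅x⁆∣≡1)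
open import Data.Nat using (zero; suc; _*_; _<_; _≤?_; z≤n; s≤s; NonZero)
open import Data.Nat.Divisibility using (divides)
open import Data.Nat.Properties
  using (≮⇒≥; +-comm; +-0-commutativeMonoid; +-cancelˡ-≤; +-monoʳ-≤; *-cancelʳ-≤; *-monoˡ-≤;
         <⇒≱; ≰⇒>; ≤-trans; ≤-reflexive; ≤-antisym; module ≤-Reasoning)
open import Data.Nat.Tactic.RingSolver using (solve-∀)
open import Data.Product using (_,_; proj₁; proj₂; ∃!)
open import Data.Sum using (inj₁; inj₂; [_,_])
open import Data.Vec using (_∷_; here; there; lookup; replicate; _[_]≔_)
open import Data.Vec.Properties using (lookup∘update; lookup∘update′; lookup-replicate)
import Data.Vec.Functional as Vector
open import Function using (_∘_; Injective)
open import Function.Bundles using (Injection)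
open import Function.Properties.Inverse using (↔⇒↣)
open import Relation.Binary.PropositionalEquality
  using (_≡_; _≢_; refl; sym; trans; cong; subst; module ≡-Reasoning)
open import Relation.Nullary using (yes; no; contradiction)
open import Relation.Nullary.Decidable using (decidable-stable)
open import Algebra.Properties.CommutativeMonoid.Sum +-0-commutativeMonoid
  using (sum-syntax; ∑-distrib-+; ∑-permute; sum-cong-≗)

indicator< : ∀ {n} → Fin n → Fin n → ℕ
indicator< i j with i <? j
... | yes _ = 1
... | no _  = 0

indicator<-trichotomy : ∀ {n} {i j : Fin n} → i ≢ j → indicator< i j + indicator< j i ≡ 1
indicator<-trichotomy {i = i} {j} i≢j with i <? j | j <? i
... | yes i<j | yes j<i = contradiction i<j (<-asym j<i)
... | yes _   | no _    = refl
... | no _    | yes _   = refl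
... | no i≮j  | no j≮i  = contradiction (Fin.≤-antisym (≮⇒≥ j≮i) (≮⇒≥ i≮j)) i≢j

∑-one : ∀ n → ∑[ i < n ] 1 ≡ n
∑-one zero    = refl
∑-one (suc n) = cong suc (∑-one n)

x+x≡x*2 : ∀ x → x + x ≡ x * 2
x+x≡x*2 = solve-∀

-- Each 2-cycle {i, τ i} has exactly one ascent, and τ maps descents onto ascents.
fixedPointFree-involution⇒even : ∀ {n} (τ : Fin n → Fin n) →
  (∀ i → τ (τ i) ≡ i) → (∀ i → τ i ≢ i) → 2 ∣ n
fixedPointFree-involution⇒even {n} τ τ-involutive τ-fixedPointFree =
  divides (∑[ i < n ] ascent i) (begin
  n                                             ≡⟨ ∑-one n ⟨
  ∑[ i < n ] 1                                  ≡⟨ sum-cong-≗ one-ascent-per-cycle ⟨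
  ∑[ i < n ] (ascent i + ascent (τ i))          ≡⟨ ∑-distrib-+ ascent (ascent ∘ τ) ⟩
  ∑[ i < n ] ascent i + ∑[ i < n ] ascent (τ i) ≡⟨ cong (∑[ i < n ] ascent i +_)
                                                      (∑-permute ascent τ↔) ⟨
  ∑[ i < n ] ascent i + ∑[ i < n ] ascent i     ≡⟨ x+x≡x*2 (∑[ i < n ] ascent i) ⟩
  ∑[ i < n ] ascent i * 2                       ∎)
  where
  open ≡-Reasoning
  ascent : Fin n → ℕ
  ascent i = indicator< i (τ i)
  τ↔ : Permutation′ n
  τ↔ = permutation τ τ τ-involutive τ-involutive
  one-ascent-per-cycle : ∀ i → ascent i + ascent (τ i) ≡ 1
  one-ascent-per-cycle i = trans (cong (λ j → ascent i + indicator< (τ i) j) (τ-involutive i))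
                                 (indicator<-trichotomy (τ-fixedPointFree i ∘ sym))

∷-injective : ∀ {a} {A : Set a} {n} {x : A} {f : Vector.Vector A n} →
  Injective _≡_ _≡_ f → (∀ i → f i ≢ x) → Injective _≡_ _≡_ (x Vector.∷ f)
∷-injective f-inj fresh {zero}  {zero}  _  = refl
∷-injective f-inj fresh {zero}  {suc j} eq = contradiction (sym eq) (fresh j)
∷-injective f-inj fresh {suc i} {zero}  eq = contradiction eq (fresh i)
∷-injective f-inj fresh {suc i} {suc j} eq = cong suc (f-inj eq)

record Distinct {n} (i j k : Fin n) : Set where
  field
    i≢j : i ≢ j
    i≢k : i ≢ k
    j≢k : j ≢ k

triple : ∀ {n} → Fin n → Fin n → Fin n → Subset n
triple i j k = ⁅ i ⁆ ∪ (⁅ j ⁆ ∪ ⁅ k ⁆)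

∣⁅x⁆∪p∣≡1+∣p∣ : ∀ {n} (x : Fin n) (p : Subset n) → x ∉ p → ∣ ⁅ x ⁆ ∪ p ∣ ≡ suc ∣ p ∣
∣⁅x⁆∪p∣≡1+∣p∣ zero    (outside ∷ p) _   = cong (λ q → 1 + ∣ q ∣) (∪-identityˡ p)
∣⁅x⁆∪p∣≡1+∣p∣ zero    (inside  ∷ p) x∉p = contradiction here x∉p
∣⁅x⁆∪p∣≡1+∣p∣ (suc x) (outside ∷ p) x∉p = ∣⁅x⁆∪p∣≡1+∣p∣ x p (x∉p ∘ there)
∣⁅x⁆∪p∣≡1+∣p∣ (suc x) (inside  ∷ p) x∉p = cong suc (∣⁅x⁆∪p∣≡1+∣p∣ x p (x∉p ∘ there))

∣triple∣≡3 : ∀ {n} {i j k : Fin n} → Distinct i j k → ∣ triple i j k ∣ ≡ 3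
∣triple∣≡3 {i = i} {j} {k} d = begin
  ∣ ⁅ i ⁆ ∪ (⁅ j ⁆ ∪ ⁅ k ⁆) ∣  ≡⟨ ∣⁅x⁆∪p∣≡1+∣p∣ i _ i∉ ⟩
  suc ∣ ⁅ j ⁆ ∪ ⁅ k ⁆ ∣        ≡⟨ cong suc (∣⁅x⁆∪p∣≡1+∣p∣ j _ (j≢k ∘ x∈⁅y⁆⇒x≡y k)) ⟩
  suc (suc ∣ ⁅ k ⁆ ∣)          ≡⟨ cong (2 +_) (∣⁅x⁆∣≡1 k) ⟩
  3                            ∎
  where
  open ≡-Reasoning
  open Distinct d
  i∉ : i ∉ ⁅ j ⁆ ∪ ⁅ k ⁆
  i∉ = [ i≢j ∘ x∈⁅y⁆⇒x≡y j , i≢k ∘ x∈⁅y⁆⇒x≡y k ] ∘ x∈p∪q⁻ ⁅ j ⁆ ⁅ k ⁆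

distinct₀₁₂ : ∀ {n} → Distinct {3 + n} zero (suc zero) (suc (suc zero))
distinct₀₁₂ = record { i≢j = λ () ; i≢k = λ () ; j≢k = λ () }

AgreeOn : ∀ {s v} → Subset s → Word s v → Word s v → Set
AgreeOn I x y = ∀ i → i ∈ I → lookup x i ≡ lookup y i

agreeOn-triple⁺ : ∀ {s v} {i j k : Fin s} {x y : Word s v} →
  lookup x i ≡ lookup y i → lookup x j ≡ lookup y j → lookup x k ≡ lookup y k →
  AgreeOn (triple i j k) x y
agreeOn-triple⁺ {i = i} {j} {k} xi xj xk l l∈ with x∈p∪q⁻ ⁅ i ⁆ _ l∈
... | inj₁ l∈i rewrite x∈⁅y⁆⇒x≡y i l∈i = xi
... | inj₂ l∈jk with x∈p∪q⁻ ⁅ j ⁆ ⁅ k ⁆ l∈jk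
...   | inj₁ l∈j rewrite x∈⁅y⁆⇒x≡y j l∈j = xj
...   | inj₂ l∈k rewrite x∈⁅y⁆⇒x≡y k l∈k = xk

agreeOn-triple⁻ : ∀ {s v} {i j k : Fin s} {x y : Word s v} → AgreeOn (triple i j k) x y →
  lookup x i ≡ lookup y i × lookup x j ≡ lookup y j × lookup x k ≡ lookup y k
agreeOn-triple⁻ {i = i} {j} {k} agree =
    agree i (x∈p∪q⁺ (inj₁ (x∈⁅x⁆ i)))
  , agree j (x∈p∪q⁺ {p = ⁅ i ⁆} (inj₂ (x∈p∪q⁺ (inj₁ (x∈⁅x⁆ j)))))
  , agree k (x∈p∪q⁺ {p = ⁅ i ⁆} (inj₂ (x∈p∪q⁺ {p = ⁅ j ⁆} (inj₂ (x∈⁅x⁆ k)))))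

IsOA : ∀ {s v} → ℕ → (Word s v → Set) → Set
IsOA {s} {v} t C =
  ∀ (I : Subset s) → ∣ I ∣ ≡ t → ∀ (a : Word s v) → ∃! _≡_ (λ x → AgreeOn I x a × C x)

Fibre : ∀ {s v} → (Word s v → Word s v) → Subset s → Word s v → Word s v → Set
Fibre φ J b x = ∀ j → j ∉ J → lookup (φ x) j ≡ lookup b j

isAONT⇒fibre-isOA : ∀ {t s v φ} → IsAONT t s v φ → ∀ {J} → ∣ J ∣ ≡ t → ∀ b → IsOA t (Fibre φ J b)
isAONT⇒fibre-isOA (_ , aont) ∣J∣≡t b I ∣I∣≡t a = aont I _ ∣I∣≡t ∣J∣≡t a b

module Strength₃ {s v} {C : Word s v → Set} (oa : IsOA 3 C) where

  record Interpolant (i j k : Fin s) (α β γ : Fin v) : Set where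
    field
      codeword   : Word s v
      isCodeword : C codeword
      at₁        : lookup codeword i ≡ α
      at₂        : lookup codeword j ≡ β
      at₃        : lookup codeword k ≡ γ

  interpolate : ∀ {i j k} → Distinct i j k → ∀ α β γ → Interpolant i j k α β γ
  interpolate {i} {j} {k} d α β γ = fromSolution (oa (triple i j k) (∣triple∣≡3 d) template)
    where
    open Distinct d
    α… αβ template : Word s v
    α… = replicate s α
    αβ = α… [ j ]≔ β
    template = αβ [ k ]≔ γ
    fromSolution : ∃! _≡_ (λ x → AgreeOn (triple i j k) x template × C x) → Interpolant i j k α β γ
    fromSolution (x , (x≈template , x∈C) , _) =
      let x≈i , x≈j , x≈k = agreeOn-triple⁻ {i = i} {j} {k} {x} {template} x≈template
      in record
        { codeword   = x
        ; isCodeword = x∈C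
        ; at₁        = trans x≈i (trans (lookup∘update′ i≢k αβ γ)
                                  (trans (lookup∘update′ i≢j α… β) (lookup-replicate i α)))
        ; at₂        = trans x≈j (trans (lookup∘update′ j≢k αβ γ) (lookup∘update j α… β))
        ; at₃        = trans x≈k (lookup∘update k αβ γ)
        }

  rigid : ∀ {i j k} → Distinct i j k → ∀ {x y} → C x → C y →
    lookup x i ≡ lookup y i → lookup x j ≡ lookup y j → lookup x k ≡ lookup y k → x ≡ y
  rigid {i} {j} {k} d {x} {y} x∈C y∈C xi xj xk with oa (triple i j k) (∣triple∣≡3 d) x
  ... | _ , _ , unique = trans (sym (unique ((λ _ _ → refl) , x∈C)))
                               (unique (agreeOn-triple⁺ {i = i} {j} {k} {y} {x}
                                          (sym xi) (sym xj) (sym xk) , y∈C))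

module ThroughAPoint {n m} {C : Word (3 + n) (suc m) → Set} (oa : IsOA 3 C)
                    (c : Fin (3 + n)) (a : Word (3 + n) (suc m)) where

  open Strength₃ oa

  W : Set
  W = Word (3 + n) (suc m)

  column : Fin (2 + n) → Fin (3 + n)
  column = punchIn c

  distinct-columns : ∀ {e e'} → e ≢ e' → Distinct c (column e) (column e')
  distinct-columns {e} {e'} e≢e' = record
    { i≢j = punchInᵢ≢i c e ∘ sym
    ; i≢k = punchInᵢ≢i c e' ∘ sym
    ; j≢k = e≢e' ∘ punchIn-injective c e e'
    }

  Through : W → Set
  Through x = C x × lookup x c ≡ lookup a c

  record Family (k : ℕ) : Set where
    field
      member    : Fin k → W
      injective : Injective _≡_ _≡_ member
      through   : ∀ l → Through (member l)

  -- Strength 3: the values at c and at two further coordinates determine a codeword.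
  family-size≤v² : ∀ {k} → Family k → k ≤ suc m * suc m
  family-size≤v² {k} F = injective⇒≤ pair-injective
    where
    open Family F
    pair : Fin k → Fin (suc m * suc m)
    pair l = combine (lookup (member l) (column zero)) (lookup (member l) (column (suc zero)))
    pair-injective : Injective _≡_ _≡_ pair
    pair-injective {l} {l'} eq =
      let eq₁ , eq₂ = combine-injective _ _ _ _ eq
      in injective (rigid (distinct-columns (λ ())) (proj₁ (through l)) (proj₁ (through l'))
                          (trans (proj₂ (through l)) (sym (proj₂ (through l')))) eq₁ eq₂)

  extend : ∀ {k} (F : Family k) {x} → Through x → (∀ l → Family.member F l ≢ x) → Family (suc k)
  extend F {x} x-through fresh = record
    { member    = x Vector.∷ member
    ; injective = ∷-injective injective fresh
    ; through   = λ { zero → x-through ; (suc l) → through l }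
    }
    where open Family F

  other : Fin (2 + n) → Fin (2 + n)
  other zero    = suc zero
  other (suc _) = zero

  e≢other : ∀ e → e ≢ other e
  e≢other zero    ()
  e≢other (suc _) ()

  neighbour : ∀ e (δ : Fin m) → Interpolant c (column e) (column (other e))
    (lookup a c) (lookup a (column e)) (punchIn (lookup a (column (other e))) δ)
  neighbour e δ = interpolate (distinct-columns (e≢other e)) _ _ _

  open Interpolant

  neighbourWord : Fin (2 + n) × Fin m → W
  neighbourWord (e , δ) = codeword (neighbour e δ)

  neighbourWord≢a : ∀ p → neighbourWord p ≢ a
  neighbourWord≢a (e , δ) eq =
    punchInᵢ≢i _ δ (trans (sym (at₃ (neighbour e δ))) (cong (λ x → lookup x (column (other e))) eq))

  neighbourWord-injective : C a → Injective _≡_ _≡_ neighbourWord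
  neighbourWord-injective a∈C {e , δ} {e' , δ'} eq with e ≟ e'
  ... | yes refl = cong (e ,_) (punchIn-injective _ δ δ'
        (trans (sym (at₃ (neighbour e δ)))
               (trans (cong (λ x → lookup x (column (other e))) eq) (at₃ (neighbour e δ')))))
  ... | no e≢e' = contradiction
        (rigid (distinct-columns e≢e') (isCodeword (neighbour e δ)) a∈C
               (at₁ (neighbour e δ)) (at₂ (neighbour e δ))
               (trans (cong (λ x → lookup x (column e')) eq) (at₂ (neighbour e' δ'))))
        (neighbourWord≢a (e , δ))

  neighbours : C a → Family ((2 + n) * m)
  neighbours a∈C = record
    { member    = neighbourWord ∘ remQuot m
    ; injective = Injection.injective (↔⇒↣ *↔×) ∘ neighbourWord-injective a∈C
    ; through   = λ l → isCodeword (neighbour _ _) , at₁ (neighbour _ _)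
    }

  neighbourhood : C a → Family (1 + (2 + n) * m)
  neighbourhood a∈C = extend (neighbours a∈C) (a∈C , refl) (neighbourWord≢a ∘ remQuot m)

  neighbourhood-size : C a → 1 + (2 + n) * m ≤ suc m * suc m
  neighbourhood-size = family-size≤v² ∘ neighbourhood

  antipode-count : C a → ∀ {b} → C b → lookup b c ≡ lookup a c →
    (∀ e → lookup b (column e) ≢ lookup a (column e)) → 2 + (2 + n) * m ≤ suc m * suc m
  antipode-count a∈C {b} b∈C b-c far =
    family-size≤v² (extend (neighbourhood a∈C) (b∈C , b-c) fresh)
    where
    fresh : ∀ l → Family.member (neighbourhood a∈C) l ≢ b
    fresh zero    a≡b = far zero (cong (λ x → lookup x (column zero)) (sym a≡b))
    fresh (suc l) N≡b =
      far _ (trans (cong (λ x → lookup x (column _)) (sym N≡b)) (at₂ (neighbour _ _)))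

  meets-again : suc m * suc m < 2 + (2 + n) * m → C a → ∀ {b} → C b → lookup b c ≡ lookup a c →
    ∃ λ x → x ≢ c × lookup b x ≡ lookup a x
  meets-again tight a∈C {b} b∈C b-c with any? (λ e → lookup b (column e) ≟ lookup a (column e))
  ... | yes (e , eq) = column e , punchInᵢ≢i c e , eq
  ... | no none      =
    contradiction (antipode-count a∈C b∈C b-c (λ e eq → none (e , eq))) (<⇒≱ tight)

square-expand : ∀ m → suc m * suc m ≡ 1 + (2 + m) * m
square-expand = solve-∀

count⇒length≤ : ∀ n m .{{_ : NonZero m}} → 1 + (2 + n) * m ≤ suc m * suc m → n ≤ m
count⇒length≤ n m count = +-cancelˡ-≤ 2 n m (*-cancelʳ-≤ (2 + n) (2 + m) m
  (+-cancelˡ-≤ 1 _ _ (≤-trans count (≤-reflexive (square-expand m)))))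

length≥⇒count> : ∀ {n m} → m ≤ n → suc m * suc m < 2 + (2 + n) * m
length≥⇒count> {n} {m} m≤n = s≤s (begin
  suc m * suc m    ≡⟨ square-expand m ⟩
  1 + (2 + m) * m  ≤⟨ s≤s (*-monoˡ-≤ m (+-monoʳ-≤ 2 m≤n)) ⟩
  1 + (2 + n) * m  ∎)
  where open ≤-Reasoning

module Pairing {n m} {C : Word (3 + n) (suc m) → Set} (oa : IsOA 3 C) (long : m ≤ n)
               {a : Word (3 + n) (suc m)} (a∈C : C a) (z : Fin m) where

  open Strength₃ oa
  open Interpolant

  from₂ : Fin (1 + n) → Fin (3 + n)
  from₂ i = suc (suc i)

  from₂-injective : ∀ {i j} → from₂ i ≡ from₂ j → i ≡ j
  from₂-injective = suc-injective ∘ suc-injective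

  distinct₀₁ : ∀ i → Distinct zero (suc zero) (from₂ i)
  distinct₀₁ i = record { i≢j = λ () ; i≢k = λ () ; j≢k = λ () }

  ray : ∀ i → Interpolant zero (suc zero) (from₂ i)
    (punchIn (lookup a zero) z) (punchIn (lookup a (suc zero)) z) (lookup a (from₂ i))
  ray i = interpolate (distinct₀₁ i) _ _ _

  ray≢a : ∀ i → codeword (ray i) ≢ a
  ray≢a i eq = punchInᵢ≢i _ z (trans (sym (at₁ (ray i))) (cong (λ x → lookup x zero) eq))

  ray-meets-a-again : ∀ i → ∃ λ j → j ≢ i × lookup (codeword (ray i)) (from₂ j) ≡ lookup a (from₂ j)
  ray-meets-a-again i = locate (proj₁ meeting) (proj₁ (proj₂ meeting)) (proj₂ (proj₂ meeting))
    where
    open ThroughAPoint oa (from₂ i) a using (meets-again)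
    meeting = meets-again (length≥⇒count> long) a∈C (isCodeword (ray i)) (at₃ (ray i))
    locate : ∀ x → x ≢ from₂ i → lookup (codeword (ray i)) x ≡ lookup a x →
      ∃ λ j → j ≢ i × lookup (codeword (ray i)) (from₂ j) ≡ lookup a (from₂ j)
    locate zero          _     eq = contradiction (trans (sym (at₁ (ray i))) eq) (punchInᵢ≢i _ z)
    locate (suc zero)    _     eq = contradiction (trans (sym (at₂ (ray i))) eq) (punchInᵢ≢i _ z)
    locate (suc (suc j)) x≢from₂-i eq = j , x≢from₂-i ∘ cong from₂ , eq

  partner : Fin (1 + n) → Fin (1 + n)
  partner i = proj₁ (ray-meets-a-again i)

  partner≢ : ∀ i → partner i ≢ i
  partner≢ i = proj₁ (proj₂ (ray-meets-a-again i))

  ray-meets-partner : ∀ i → lookup (codeword (ray i)) (from₂ (partner i)) ≡ lookup a (from₂ (partner i))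
  ray-meets-partner i = proj₂ (proj₂ (ray-meets-a-again i))

  ray-partner : ∀ i → codeword (ray (partner i)) ≡ codeword (ray i)
  ray-partner i = rigid (distinct₀₁ (partner i))
    (isCodeword (ray (partner i))) (isCodeword (ray i))
    (trans (at₁ (ray (partner i))) (sym (at₁ (ray i))))
    (trans (at₂ (ray (partner i))) (sym (at₂ (ray i))))
    (trans (at₃ (ray (partner i))) (sym (ray-meets-partner i)))

  -- Otherwise ray i would agree with a at three coordinates.
  partner-involutive : ∀ i → partner (partner i) ≡ i
  partner-involutive i = decidable-stable (partner (partner i) ≟ i) λ pp≢i →
    ray≢a i (rigid (distinct pp≢i) (isCodeword (ray i)) a∈C (at₃ (ray i)) (ray-meets-partner i) meets-pp)
    where
    p = partner i
    pp = partner p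
    distinct : pp ≢ i → Distinct (from₂ i) (from₂ p) (from₂ pp)
    distinct pp≢i = record
      { i≢j = partner≢ i ∘ sym ∘ from₂-injective
      ; i≢k = pp≢i ∘ sym ∘ from₂-injective
      ; j≢k = partner≢ p ∘ sym ∘ from₂-injective
      }
    meets-pp : lookup (codeword (ray i)) (from₂ pp) ≡ lookup a (from₂ pp)
    meets-pp = trans (cong (λ x → lookup x (from₂ pp)) (sym (ray-partner i))) (ray-meets-partner p)

  even : 2 ∣ suc n
  even = fixedPointFree-involution⇒even partner partner-involutive partner≢

module LengthBounds {n m} {C : Word (3 + n) (2 + m) → Set} (oa : IsOA 3 C) where

  open Strength₃ oa

  open Interpolant (interpolate distinct₀₁₂ zero zero zero) renaming (codeword to a; isCodeword to a∈C)

  length≤ : n ≤ suc m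
  length≤ = count⇒length≤ n (suc m) (ThroughAPoint.neighbourhood-size oa zero a a∈C)

  long⇒even : suc m ≤ n → 2 ∣ suc n
  long⇒even long = Pairing.even oa long a∈C zero

fibre₀₁₂-isOA : ∀ {n m φ} → IsAONT 3 (3 + n) (suc m) φ →
  IsOA 3 (Fibre φ (triple zero (suc zero) (suc (suc zero))) (replicate _ zero))
fibre₀₁₂-isOA {n} aont = isAONT⇒fibre-isOA aont (∣triple∣≡3 (distinct₀₁₂ {n})) (replicate _ zero)

aont₃-length≤ : ∀ {s v φ} → 3 ≤ s → 2 ≤ v → IsAONT 3 s v φ → s ≤ v + 2
aont₃-length≤ {v = v} (s≤s (s≤s (s≤s _))) (s≤s (s≤s _)) aont =
  ≤-trans (+-monoʳ-≤ 3 length≤) (≤-reflexive (+-comm 2 v))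
  where open LengthBounds (fibre₀₁₂-isOA aont)

aont₃-odd-length≤ : ∀ {s v φ} → 3 ≤ s → 2 ≤ v → ¬ (2 ∣ v) → IsAONT 3 s v φ → s ≤ v + 1
aont₃-odd-length≤ {v = v} (s≤s (s≤s (s≤s {n = n} _))) (s≤s (s≤s {n = m} _)) odd aont
  with n ≤? m
... | yes n≤m = ≤-trans (+-monoʳ-≤ 3 n≤m) (≤-reflexive (+-comm 1 v))
... | no  n≰m = contradiction (subst (2 ∣_) (cong suc n≡1+m) (long⇒even 1+m≤n)) odd
  where
  open LengthBounds (fibre₀₁₂-isOA aont)
  1+m≤n : suc m ≤ n
  1+m≤n = ≰⇒> n≰m
  n≡1+m : n ≡ suc m
  n≡1+m = ≤-antisym length≤ 1+m≤n

corollary25 : (v s : ℕ) → 3 ≤ s → ∃ (λ (φ : Word s v → Word s v) → IsAONT 3 s v φ) →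
    ((2 ∣ v) → 4 ≤ v → s ≤ v + 2) × ((¬ (2 ∣ v)) → 3 ≤ v → s ≤ v + 1)
corollary25 v s 3≤s (φ , aont) =
    (λ _ 4≤v → aont₃-length≤ 3≤s (≤-trans (s≤s (s≤s z≤n)) 4≤v) aont)
  , (λ odd 3≤v → aont₃-odd-length≤ 3≤s (≤-trans (s≤s (s≤s z≤n)) 3≤v) odd aont)
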